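{- Let $p<q$ be positive integers with $q-p$ even, let $b=\frac{q-p}{2}$, and assume $p\ge 2b$. Then for every integer $i$ with $0\le i\le p-2b$, the set $\{i+1,i+2,\dots,i+2b\}$ is consistent with respect to the control sequence for $(p,q)$.
   Context: The control sequence for $(p,q)$ is the infinite sequence of brackets $\beta_1,\beta_2,\dots$, where $\beta_j\subseteq\{1,\dots,q\}$ consists of the numbers $(j-1)b+1,(j-1)b+2,\dots,(j-1)b+p$, each reduced modulo $q$ into the range $\{1,\dots,q\}$. For $x\in\beta_j$, the occurrence number of $x$ in bracket $j$ is $|\{j'\le j: x\in\beta_{j'}\}|$. Two numbers $x,y$ are in contradiction in bracket $j$ if $x,y\in\beta_j$ and the occurrence number of $y$ in bracket $j$ equals the occurrence number of $x$ in bracket $j$ plus $2$. A subset of $\{1,\dots,q\}$ is consistent if no two of its elements are in contradiction in any bracket. -}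

module Defs where

open import Data.Nat using (ℕ; zero; suc; _+_; _*_; _∸_; _≤_; _<_)
open import Data.Nat.Properties using (_≟_)
open import Data.Nat.DivMod using (_%_)
open import Data.List using (List; map; filter; length; upTo)
open import Data.List.Membership.Propositional using (_∈_)
open import Data.List.Membership.DecPropositional _≟_ using (_∈?_)
open import Relation.Nullary using (¬_)

-- reduce n modulo q into the range {1,…,q}  (q = 0 is a junk case, never used)
red : ℕ → ℕ → ℕ
red zero    n = n
red (suc q) n = suc ((n ∸ 1) % suc q)

oneTo : ℕ → List ℕ
oneTo n = map suc (upTo n)

-- bracket β_j of the control sequence for (p,q), b = (q-p)/2 (for j ≥ 1):
-- the numbers (j-1)b+1, …, (j-1)b+p reduced modulo q into {1,…,q}
bracket : (p q b : ℕ) → ℕ → List ℕ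
bracket p q b j = map (λ k → red q ((j ∸ 1) * b + k)) (oneTo p)

occ : (p q b : ℕ) → ℕ → ℕ → ℕ
occ p q b x j = length (filter (λ j' → x ∈? bracket p q b j') (oneTo j))

InContradiction : (p q b : ℕ) → ℕ → ℕ → ℕ → Set
InContradiction p q b x y j =
  x ∈ bracket p q b j × y ∈ bracket p q b j × occ p q b y j ≡ occ p q b x j + 2
  where
    open import Data.Product using (_×_)
    open import Relation.Binary.PropositionalEquality using (_≡_)

Consistent : (p q b : ℕ) → (ℕ → Set) → Set
Consistent p q b S =
  ∀ x y j → 1 ≤ j → S x → S y → ¬ InContradiction p q b x y j

Interval : ℕ → ℕ → ℕ → Set
Interval i m x = i + 1 ≤ x × x ≤ i + m
  where open import Data.Product using (_×_)

module Submission where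

-- With w = 2b, q = p + w and Q = q − 1, the number 1 + u lies in bracket k + 1 iff its phase
-- (k b + Q − u) mod q avoids the gap [0, w). Along the control sequence every phase advances by b
-- on the circle of length q. For x < y in an interval of length w, the phase of x is that of y
-- shifted by δ = y − x < w. Whenever y is in a bracket but x is not, two brackets later x is in
-- and y is not, and these are the only discrepancies. So if x and y both lie in bracket j, neither
-- of the two preceding brackets has an unmatched discrepancy, and x and y have the same
-- occurrence number in bracket j.

open import Defs
open import Data.Nat
open import Data.Nat.Properties
open import Data.Nat.DivMod
open import Data.Product using (∃; _×_; _,_)
open import Data.Sum using (inj₁; inj₂)
open import Data.Empty using (⊥-elim)
open import Data.List using (map; filter; length; upTo; _++_; [_])
open import Data.List.Properties using (upTo-∷ʳ; map-++; filter-++; length-++)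
open import Data.List.Membership.Propositional using (_∈_)
open import Data.List.Membership.Propositional.Properties using (∈-map⁺; ∈-map⁻; ∈-upTo⁺; ∈-upTo⁻)
open import Data.List.Membership.DecPropositional _≟_ using (_∈?_)
open import Function using (_∘_; case_of_)
open import Function.Bundles using (_⇔_; mk⇔; Equivalence)
open import Relation.Nullary using (¬_; Dec; yes; no)
open import Relation.Unary using (Decidable)
open import Relation.Binary.PropositionalEquality hiding ([_])
open import Algebra.Properties.CommutativeSemigroup +-commutativeSemigroup using (interchange; xy∙z≈xz∙y)

𝟙 : {P : Set} → Dec P → ℕ
𝟙 (yes _) = 1
𝟙 (no _)  = 0

𝟙-cong : {P Q : Set} (d : Dec P) (e : Dec Q) → P ⇔ Q → 𝟙 d ≡ 𝟙 e
𝟙-cong (yes _) (yes _) _   = refl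
𝟙-cong (yes p) (no ¬q) P⇔Q = ⊥-elim (¬q (Equivalence.to P⇔Q p))
𝟙-cong (no ¬p) (yes q) P⇔Q = ⊥-elim (¬p (Equivalence.from P⇔Q q))
𝟙-cong (no _)  (no _)  _   = refl

𝟙-∸-𝟙≡0 : {P Q : Set} (d : Dec P) (e : Dec Q) → (P → Q) → 𝟙 d ∸ 𝟙 e ≡ 0
𝟙-∸-𝟙≡0 (yes p) (yes _) _   = refl
𝟙-∸-𝟙≡0 (yes p) (no ¬q) P→Q = ⊥-elim (¬q (P→Q p))
𝟙-∸-𝟙≡0 (no _)  (yes _) _   = refl
𝟙-∸-𝟙≡0 (no _)  (no _)  _   = refl

𝟙-∸-𝟙≡1 : {P Q : Set} (d : Dec P) (e : Dec Q) → P → ¬ Q → 𝟙 d ∸ 𝟙 e ≡ 1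
𝟙-∸-𝟙≡1 (yes _) (no _)  _ _  = refl
𝟙-∸-𝟙≡1 (yes _) (yes q) _ ¬q = ⊥-elim (¬q q)
𝟙-∸-𝟙≡1 (no ¬p) _       p _  = ⊥-elim (¬p p)

m+[n∸m]≡n+[m∸n] : ∀ m n → m + (n ∸ m) ≡ n + (m ∸ n)
m+[n∸m]≡n+[m∸n] zero    n       = sym (trans (cong (n +_) (0∸n≡0 n)) (+-identityʳ n))
m+[n∸m]≡n+[m∸n] (suc m) zero    = +-identityʳ (suc m)
m+[n∸m]≡n+[m∸n] (suc m) (suc n) = cong suc (m+[n∸m]≡n+[m∸n] m n)

∑< : ℕ → (ℕ → ℕ) → ℕ
∑< zero    f = 0
∑< (suc n) f = ∑< n f + f n

∑<-cong : ∀ {f g} n → (∀ k → f k ≡ g k) → ∑< n f ≡ ∑< n g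
∑<-cong zero    f≡g = refl
∑<-cong (suc n) f≡g = cong₂ _+_ (∑<-cong n f≡g) (f≡g n)

∑<-+ : ∀ f g n → ∑< n (λ k → f k + g k) ≡ ∑< n f + ∑< n g
∑<-+ f g zero    = refl
∑<-+ f g (suc n) = begin
  ∑< n (λ k → f k + g k) + (f n + g n) ≡⟨ cong (_+ (f n + g n)) (∑<-+ f g n) ⟩
  (∑< n f + ∑< n g) + (f n + g n)       ≡⟨ interchange (∑< n f) (∑< n g) (f n) (g n) ⟩
  (∑< n f + f n) + (∑< n g + g n)       ∎
  where open ≡-Reasoning

length-filter-oneTo : ∀ {P : ℕ → Set} (P? : Decidable P) n →
                      length (filter P? (oneTo n)) ≡ ∑< n (λ k → 𝟙 (P? (suc k)))
length-filter-oneTo P? zero    = refl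
length-filter-oneTo P? (suc n) = begin
  length (filter P? (map suc (upTo (suc n))))          ≡⟨ cong (length ∘ filter P? ∘ map suc) (sym (upTo-∷ʳ n)) ⟩
  length (filter P? (map suc (upTo n ++ [ n ])))       ≡⟨ cong (length ∘ filter P?) (map-++ suc (upTo n) [ n ]) ⟩
  length (filter P? (oneTo n ++ [ suc n ]))            ≡⟨ cong length (filter-++ P? (oneTo n) [ suc n ]) ⟩
  length (filter P? (oneTo n) ++ filter P? [ suc n ])  ≡⟨ length-++ (filter P? (oneTo n)) ⟩
  length (filter P? (oneTo n)) + length (filter P? [ suc n ])
    ≡⟨ cong₂ _+_ (length-filter-oneTo P? n) (length-filter-[ suc n ]) ⟩
  ∑< n (λ k → 𝟙 (P? (suc k))) + 𝟙 (P? (suc n))         ∎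
  where
    open ≡-Reasoning
    length-filter-[_] : ∀ x → length (filter P? [ x ]) ≡ 𝟙 (P? x)
    length-filter-[ x ] with P? x
    ... | yes _ = refl
    ... | no _  = refl

[m%n+o]%n≡[m+o]%n : ∀ m o n .{{_ : NonZero n}} → (m % n + o) % n ≡ (m + o) % n
[m%n+o]%n≡[m+o]%n m o n = begin
  (m % n + o) % n          ≡⟨ %-distribˡ-+ (m % n) o n ⟩
  (m % n % n + o % n) % n  ≡⟨ cong (λ r → (r + o % n) % n) (m%n%n≡m%n m n) ⟩
  (m % n + o % n) % n      ≡⟨ %-distribˡ-+ m o n ⟨
  (m + o) % n              ∎
  where open ≡-Reasoning

data Wrap (q n : ℕ) : Set where
  below : n < q → Wrap q n
  above : ∀ c → n ≡ c + q → Wrap q n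

wrap? : ∀ q n → Wrap q n
wrap? q n with n <? q
... | yes n<q = below n<q
... | no  n≮q = above (n ∸ q) (sym (m∸n+n≡m (≮⇒≥ n≮q)))

%-above : ∀ {n c} q .{{_ : NonZero q}} → n ≡ c + q → c < q → n % q ≡ c
%-above q refl c<q = trans ([m+n]%n≡m%n _ q) (m<n⇒m%n≡m c<q)

wrap-excess< : ∀ {m t c q} → m < q → m + t ≡ c + q → c < t
wrap-excess< {m} {t} {c} {q} m<q eq = +-cancelʳ-< q c t (begin-strict
  c + q  ≡⟨ eq ⟨
  m + t  <⟨ +-monoˡ-< t m<q ⟩
  q + t  ≡⟨ +-comm q t ⟩
  t + q  ∎)
  where open ≤-Reasoning

wrap-excess+<  : ∀ {m s t c q} → m + s < q → m + t ≡ c + q → c + s < t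
wrap-excess+< {m} {s} {t} {c} {q} m+s<q eq = +-cancelʳ-< q (c + s) t (begin-strict
  (c + s) + q  ≡⟨ xy∙z≈xz∙y c s q ⟩
  (c + q) + s  ≡⟨ cong (_+ s) eq ⟨
  (m + t) + s  ≡⟨ xy∙z≈xz∙y m t s ⟩
  (m + s) + t  <⟨ +-monoˡ-< t m+s<q ⟩
  q + t        ≡⟨ +-comm q t ⟩
  t + q        ∎)
  where open ≤-Reasoning

-- Both hypothesis and conclusion say that N + s + (Q ∸ u) ≡ Q modulo 1 + Q.
%-reflect : ∀ {Q s u} N → s ≤ Q → u ≤ Q → (N + s) % suc Q ≡ u → (N + (Q ∸ u)) % suc Q ≡ Q ∸ s
%-reflect {Q} {s} {u} N s≤Q u≤Q eq = begin
  (N + (Q ∸ u)) % suc Q        ≡⟨ cong (_% suc Q) (+-cancelʳ-≡ s _ _ shifted) ⟩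
  ((Q ∸ s) + m * suc Q) % suc Q ≡⟨ [m+kn]%n≡m%n (Q ∸ s) m (suc Q) ⟩
  (Q ∸ s) % suc Q              ≡⟨ m<n⇒m%n≡m (s≤s (m∸n≤m Q s)) ⟩
  Q ∸ s                        ∎
  where
    open ≡-Reasoning
    m : ℕ
    m = (N + s) / suc Q
    shifted : (N + (Q ∸ u)) + s ≡ ((Q ∸ s) + m * suc Q) + s
    shifted = begin
      (N + (Q ∸ u)) + s               ≡⟨ xy∙z≈xz∙y N (Q ∸ u) s ⟩
      (N + s) + (Q ∸ u)               ≡⟨ cong (_+ (Q ∸ u)) (m≡m%n+[m/n]*n (N + s) (suc Q)) ⟩
      ((N + s) % suc Q + m * suc Q) + (Q ∸ u) ≡⟨ cong (λ r → (r + m * suc Q) + (Q ∸ u)) eq ⟩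
      (u + m * suc Q) + (Q ∸ u)       ≡⟨ xy∙z≈xz∙y u (m * suc Q) (Q ∸ u) ⟩
      (u + (Q ∸ u)) + m * suc Q       ≡⟨ cong (_+ m * suc Q) (trans (m+[n∸m]≡n u≤Q) (sym (m∸n+n≡m s≤Q))) ⟩
      ((Q ∸ s) + s) + m * suc Q       ≡⟨ xy∙z≈xz∙y (Q ∸ s) s (m * suc Q) ⟩
      ((Q ∸ s) + m * suc Q) + s       ∎

phase : (q b : ℕ) .{{_ : NonZero q}} → ℕ → ℕ → ℕ
phase q b a k = (k * b + a) % q

module _ {q b : ℕ} .{{_ : NonZero q}} where

  phase-suc : ∀ a k → phase q b a (suc k) ≡ (phase q b a k + b) % q
  phase-suc a k = begin
    (b + k * b + a) % q        ≡⟨ cong (_% q) (trans (+-assoc b (k * b) a) (+-comm b (k * b + a))) ⟩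
    (k * b + a + b) % q        ≡⟨ [m%n+o]%n≡[m+o]%n (k * b + a) b q ⟨
    ((k * b + a) % q + b) % q  ∎
    where open ≡-Reasoning

  phase-2+ : ∀ a k → phase q b a (2 + k) ≡ (phase q b a k + (b + b)) % q
  phase-2+ a k = begin
    phase q b a (2 + k)                      ≡⟨ phase-suc a (suc k) ⟩
    (phase q b a (suc k) + b) % q            ≡⟨ cong (λ r → (r + b) % q) (phase-suc a k) ⟩
    ((phase q b a k + b) % q + b) % q        ≡⟨ [m%n+o]%n≡[m+o]%n (phase q b a k + b) b q ⟩
    (phase q b a k + b + b) % q              ≡⟨ cong (_% q) (+-assoc (phase q b a k) b b) ⟩
    (phase q b a k + (b + b)) % q            ∎
    where open ≡-Reasoning

  phase-+ : ∀ a δ k → phase q b (a + δ) k ≡ (phase q b a k + δ) % q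
  phase-+ a δ k = trans (cong (_% q) (sym (+-assoc (k * b) a δ))) (sym ([m%n+o]%n≡[m+o]%n (k * b + a) δ q))

module ShiftedOrbits {q b w a δ : ℕ} .{{_ : NonZero q}}
  (w≡b+b : w ≡ b + b) (w+w≤q : w + w ≤ q) (δ<w : δ < w) (w≤a : w ≤ a) (a+δ<q : a + δ < q) where

  g h : ℕ → ℕ
  g = phase q b a
  h = phase q b (a + δ)

  covered : ℕ → ℕ
  covered z = 𝟙 (w ≤? z)

  onlyG onlyH : ℕ → ℕ
  onlyG k = covered (g k) ∸ covered (h k)
  onlyH k = covered (h k) ∸ covered (g k)

  private
    w≤q : w ≤ q
    w≤q = ≤-trans (m≤m+n w w) w+w≤q

    b≤w : b ≤ w
    b≤w = subst (b ≤_) (sym w≡b+b) (m≤m+n b b)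

    <w⇒<q : ∀ {n} → n < w → n < q
    <w⇒<q n<w = <-≤-trans n<w w≤q

    g<q : ∀ k → g k < q
    g<q k = m%n<n (k * b + a) q

    h≡g+δ : ∀ k → h k ≡ (g k + δ) % q
    h≡g+δ = phase-+ a δ

    g-2+ : ∀ k → g (2 + k) ≡ (g k + w) % q
    g-2+ k = trans (phase-2+ a k) (cong (λ v → (g k + v) % q) (sym w≡b+b))

    onlyG≡0 : ∀ k → (w ≤ g k → w ≤ h k) → onlyG k ≡ 0
    onlyG≡0 k = 𝟙-∸-𝟙≡0 (w ≤? g k) (w ≤? h k)

    onlyH≡0 : ∀ k → (w ≤ h k → w ≤ g k) → onlyH k ≡ 0
    onlyH≡0 k = 𝟙-∸-𝟙≡0 (w ≤? h k) (w ≤? g k)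

  onlyH-0 : onlyH 0 ≡ 0
  onlyH-0 = onlyH≡0 0 (λ _ → subst (w ≤_) (sym (m<n⇒m%n≡m a<q)) w≤a)
    where
      a<q : a < q
      a<q = ≤-<-trans (m≤m+n a δ) a+δ<q

  onlyH-1 : onlyH 1 ≡ 0
  onlyH-1 with wrap? q (a + δ + b)
  ... | below a+δ+b<q = onlyH≡0 1 (λ _ → subst (w ≤_) (sym g1≡a+b) w≤a+b)
    where
      a+b<q : a + b < q
      a+b<q = ≤-<-trans (+-monoˡ-≤ b (m≤m+n a δ)) a+δ+b<q
      g1≡a+b : g 1 ≡ a + b
      g1≡a+b = trans (phase-suc a 0) (trans ([m%n+o]%n≡[m+o]%n a b q) (m<n⇒m%n≡m a+b<q))
      w≤a+b : w ≤ a + b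
      w≤a+b = ≤-trans w≤a (m≤m+n a b)
  ... | above c eq = onlyH≡0 1 (λ w≤h1 → ⊥-elim (<⇒≱ (subst (_< w) (sym h1≡c) c<w) w≤h1))
    where
      c<w : c < w
      c<w = <-≤-trans (wrap-excess< a+δ<q eq) b≤w
      h1≡c : h 1 ≡ c
      h1≡c = trans (phase-suc (a + δ) 0)
               (trans ([m%n+o]%n≡[m+o]%n (a + δ) b q) (%-above q eq (<w⇒<q c<w)))

  onlyG-within : ∀ k → g k + δ < q → onlyG k ≡ 0
  onlyG-within k lt = onlyG≡0 k (λ w≤g → ≤-trans w≤g g≤h)
    where
      g≤h : g k ≤ h k
      g≤h = subst (g k ≤_) (sym (trans (h≡g+δ k) (m<n⇒m%n≡m lt))) (m≤m+n (g k) δ)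

  onlyH-2+-within : ∀ k → g k + δ < q → onlyH (2 + k) ≡ 0
  onlyH-2+-within k g+δ<q with wrap? q (g k + w)
  ... | below lt = onlyH≡0 (2 + k) (λ _ → subst (w ≤_) (sym g2≡) (m≤n+m w (g k)))
    where
      g2≡ : g (2 + k) ≡ g k + w
      g2≡ = trans (g-2+ k) (m<n⇒m%n≡m lt)
  ... | above c eq = onlyH≡0 (2 + k) (λ w≤h → ⊥-elim (<⇒≱ (subst (_< w) (sym h2≡) c+δ<w) w≤h))
    where
      c+δ<w : c + δ < w
      c+δ<w = wrap-excess+< g+δ<q eq
      c<q : c < q
      c<q = <w⇒<q (wrap-excess< (g<q k) eq)
      h2≡ : h (2 + k) ≡ c + δ
      h2≡ = begin
        h (2 + k)              ≡⟨ h≡g+δ (2 + k) ⟩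
        (g (2 + k) + δ) % q    ≡⟨ cong (λ r → (r + δ) % q) (trans (g-2+ k) (%-above q eq c<q)) ⟩
        (c + δ) % q            ≡⟨ m<n⇒m%n≡m (<w⇒<q c+δ<w) ⟩
        c + δ                  ∎
        where open ≡-Reasoning

  module Wrapped {k c : ℕ} (eq : g k + δ ≡ c + q) where

    c<w : c < w
    c<w = <-trans (wrap-excess< (g<q k) eq) δ<w

    onlyG≡1 : onlyG k ≡ 1
    onlyG≡1 = 𝟙-∸-𝟙≡1 (w ≤? g k) (w ≤? h k) (<⇒≤ w<g) (<⇒≱ (subst (_< w) (sym h≡c) c<w))
      where
        h≡c : h k ≡ c
        h≡c = trans (h≡g+δ k) (%-above q eq (<w⇒<q c<w))
        w<g : w < g k
        w<g = +-cancelʳ-< δ w (g k) (begin-strict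
          w + δ   <⟨ +-monoʳ-< w δ<w ⟩
          w + w   ≤⟨ w+w≤q ⟩
          q       ≤⟨ m≤n+m q c ⟩
          c + q   ≡⟨ eq ⟨
          g k + δ ∎)
          where open ≤-Reasoning

    onlyH-2+≡1 : onlyH (2 + k) ≡ 1
    onlyH-2+≡1 with wrap? q (g k + w)
    ... | below lt = ⊥-elim (<⇒≱ lt q≤g+w)
      where
        q≤g+w : q ≤ g k + w
        q≤g+w = ≤-trans (m≤n+m q c) (≤-trans (≤-reflexive (sym eq)) (+-monoʳ-≤ (g k) (<⇒≤ δ<w)))
    ... | above c′ eq′ = 𝟙-∸-𝟙≡1 (w ≤? h (2 + k)) (w ≤? g (2 + k))
                           (subst (w ≤_) (sym h2≡c+w) (m≤n+m w c)) (<⇒≱ (subst (_< w) (sym g2≡c′) c′<w))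
      where
        c′<w : c′ < w
        c′<w = wrap-excess< (g<q k) eq′
        g2≡c′ : g (2 + k) ≡ c′
        g2≡c′ = trans (g-2+ k) (%-above q eq′ (<w⇒<q c′<w))
        c′+δ≡c+w : c′ + δ ≡ c + w
        c′+δ≡c+w = +-cancelʳ-≡ q _ _ (begin
          (c′ + δ) + q   ≡⟨ xy∙z≈xz∙y c′ δ q ⟩
          (c′ + q) + δ   ≡⟨ cong (_+ δ) eq′ ⟨
          (g k + w) + δ  ≡⟨ xy∙z≈xz∙y (g k) w δ ⟩
          (g k + δ) + w  ≡⟨ cong (_+ w) eq ⟩
          (c + q) + w    ≡⟨ xy∙z≈xz∙y c q w ⟩
          (c + w) + q    ∎)
          where open ≡-Reasoning
        h2≡c+w : h (2 + k) ≡ c + w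
        h2≡c+w = begin
          h (2 + k)            ≡⟨ h≡g+δ (2 + k) ⟩
          (g (2 + k) + δ) % q  ≡⟨ cong (λ r → (r + δ) % q) g2≡c′ ⟩
          (c′ + δ) % q         ≡⟨ cong (_% q) c′+δ≡c+w ⟩
          (c + w) % q          ≡⟨ m<n⇒m%n≡m (<-≤-trans (+-monoˡ-< w c<w) w+w≤q) ⟩
          c + w                ∎
          where open ≡-Reasoning

  -- Only g is covered at k exactly when adding δ wraps h k into the gap; two steps later g has
  -- advanced by w into the gap while h has just left it.
  onlyG≡onlyH-2+ : ∀ k → onlyG k ≡ onlyH (2 + k)
  onlyG≡onlyH-2+ k with wrap? q (g k + δ)
  ... | below lt   = trans (onlyG-within k lt) (sym (onlyH-2+-within k lt))
  ... | above c eq = trans onlyG≡1 (sym onlyH-2+≡1)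
    where open Wrapped {k} eq

  onlyG-before-common : ∀ k → w ≤ g (1 + k) → w ≤ h (1 + k) → onlyG k ≡ 0
  onlyG-before-common k w≤g′ w≤h′ with wrap? q (g k + δ)
  ... | below lt = onlyG-within k lt
  ... | above c eq with wrap? q (g k + b)
  ...   | below lt = ⊥-elim (<⇒≱ (subst (_< w) (sym h′≡c+b) c+b<w) w≤h′)
    where
      c+b<w : c + b < w
      c+b<w = <-trans (wrap-excess+< lt eq) δ<w
      h′≡c+b : h (1 + k) ≡ c + b
      h′≡c+b = begin
        h (1 + k)        ≡⟨ phase-suc (a + δ) k ⟩
        (h k + b) % q    ≡⟨ cong (λ r → (r + b) % q) (trans (h≡g+δ k) (%-above q eq (<w⇒<q (Wrapped.c<w {k} eq)))) ⟩
        (c + b) % q      ≡⟨ m<n⇒m%n≡m (<w⇒<q c+b<w) ⟩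
        c + b            ∎
        where open ≡-Reasoning
  ...   | above c′ eq′ = ⊥-elim (<⇒≱ (subst (_< w) (sym g′≡c′) c′<w) w≤g′)
    where
      c′<w : c′ < w
      c′<w = <-≤-trans (wrap-excess< (g<q k) eq′) b≤w
      g′≡c′ : g (1 + k) ≡ c′
      g′≡c′ = trans (phase-suc a k) (%-above q eq′ (<w⇒<q c′<w))

  ∑<onlyH≡∑<onlyG : ∀ n → ∑< (2 + n) onlyH ≡ ∑< n onlyG
  ∑<onlyH≡∑<onlyG zero    = cong₂ _+_ (cong (0 +_) onlyH-0) onlyH-1
  ∑<onlyH≡∑<onlyG (suc n) = cong₂ _+_ (∑<onlyH≡∑<onlyG n) (sym (onlyG≡onlyH-2+ n))

  ∑<onlyG≡∑<onlyH-at-common : ∀ k → w ≤ g k → w ≤ h k → ∑< (1 + k) onlyG ≡ ∑< (1 + k) onlyH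
  ∑<onlyG≡∑<onlyH-at-common zero    _   w≤h = cong (0 +_) (trans (onlyG≡0 0 (λ _ → w≤h)) (sym onlyH-0))
  ∑<onlyG≡∑<onlyH-at-common (suc k) w≤g w≤h = begin
    (∑< k onlyG + onlyG k) + onlyG (1 + k)  ≡⟨ cong₂ (λ x y → (∑< k onlyG + x) + y)
                                                 (onlyG-before-common k w≤g w≤h) (onlyG≡0 (1 + k) (λ _ → w≤h)) ⟩
    (∑< k onlyG + 0) + 0                    ≡⟨ trans (+-identityʳ _) (+-identityʳ _) ⟩
    ∑< k onlyG                              ≡⟨ ∑<onlyH≡∑<onlyG k ⟨
    ∑< (2 + k) onlyH                        ∎
    where open ≡-Reasoning

  counts-agree : ∀ k → w ≤ g k → w ≤ h k → ∑< (1 + k) (covered ∘ g) ≡ ∑< (1 + k) (covered ∘ h)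
  counts-agree k w≤g w≤h = +-cancelʳ-≡ (∑< n onlyH) _ _ (begin
    ∑< n (covered ∘ g) + ∑< n onlyH            ≡⟨ ∑<-+ (covered ∘ g) onlyH n ⟨
    ∑< n (λ j → covered (g j) + onlyH j)      ≡⟨ ∑<-cong n (λ j → m+[n∸m]≡n+[m∸n] (covered (g j)) (covered (h j))) ⟩
    ∑< n (λ j → covered (h j) + onlyG j)      ≡⟨ ∑<-+ (covered ∘ h) onlyG n ⟩
    ∑< n (covered ∘ h) + ∑< n onlyG            ≡⟨ cong (∑< n (covered ∘ h) +_) (∑<onlyG≡∑<onlyH-at-common k w≤g w≤h) ⟩
    ∑< n (covered ∘ h) + ∑< n onlyH            ∎)
    where
      open ≡-Reasoning
      n : ℕ
      n = 1 + k

red-+suc : ∀ Q N s → red (suc Q) (N + suc s) ≡ suc ((N + s) % suc Q)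
red-+suc Q N s = cong (λ n → suc ((n ∸ 1) % suc Q)) (+-suc N s)

∈-bracket⁻ : ∀ {p Q b k x} → x ∈ bracket p (suc Q) b (suc k) → ∃ λ s → s < p × x ≡ suc ((k * b + s) % suc Q)
∈-bracket⁻ {Q = Q} {b} {k} x∈ with ∈-map⁻ (λ t → red (suc Q) (k * b + t)) x∈
... | t , t∈ , refl with ∈-map⁻ suc t∈
... | s , s∈ , refl = s , ∈-upTo⁻ s∈ , red-+suc Q (k * b) s

∈-bracket⁺ : ∀ {p Q b k s} → s < p → suc ((k * b + s) % suc Q) ∈ bracket p (suc Q) b (suc k)
∈-bracket⁺ {p} {Q} {b} {k} {s} s<p =
  subst (_∈ bracket p (suc Q) b (suc k)) (red-+suc Q (k * b) s)
        (∈-map⁺ (λ t → red (suc Q) (k * b + t)) (∈-map⁺ suc (∈-upTo⁺ s<p)))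

m≤[n+m]∸o : ∀ {m n o} → o ≤ n → m ≤ n + m ∸ o
m≤[n+m]∸o {m} {n} {o} o≤n = m+n≤o⇒m≤o∸n m (subst (_≤ n + m) (+-comm o m) (+-monoˡ-≤ m o≤n))

∈-bracket⇔covered : ∀ {p′ w b u} k → u ≤ p′ + w →
  suc u ∈ bracket (suc p′) (suc (p′ + w)) b (suc k) ⇔ w ≤ phase (suc (p′ + w)) b (p′ + w ∸ u) k
∈-bracket⇔covered {p′} {w} {b} {u} k u≤Q = mk⇔ to from
  where
    Q : ℕ
    Q = p′ + w

    to : suc u ∈ bracket (suc p′) (suc Q) b (suc k) → w ≤ phase (suc Q) b (Q ∸ u) k
    to u∈ with ∈-bracket⁻ {suc p′} {Q} {b} {k} u∈
    ... | s , s<p , u≡ =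
      subst (w ≤_) (sym (%-reflect (k * b) s≤Q u≤Q (sym (suc-injective u≡)))) (m≤[n+m]∸o (≤-pred s<p))
      where
        s≤Q : s ≤ Q
        s≤Q = ≤-trans (≤-pred s<p) (m≤m+n p′ w)

    from : w ≤ phase (suc Q) b (Q ∸ u) k → suc u ∈ bracket (suc p′) (suc Q) b (suc k)
    from w≤r = subst (_∈ bracket (suc p′) (suc Q) b (suc k)) (cong suc u≡) (∈-bracket⁺ {suc p′} {Q} {b} {k} s<p)
      where
        r s : ℕ
        r = phase (suc Q) b (Q ∸ u) k
        s = Q ∸ r
        s<p : s < suc p′
        s<p = s≤s (subst (s ≤_) (m+n∸n≡m p′ w) (∸-monoʳ-≤ Q w≤r))
        u≡ : (k * b + s) % suc Q ≡ u
        u≡ = trans (%-reflect (k * b) (m∸n≤m Q u) (≤-pred (m%n<n (k * b + (Q ∸ u)) (suc Q))) refl)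
                   (m∸[m∸n]≡n u≤Q)

occ≡∑<covered : ∀ {p′ w b u} k → u ≤ p′ + w →
  occ (suc p′) (suc (p′ + w)) b (suc u) (suc k) ≡
  ∑< (suc k) (λ j → 𝟙 (w ≤? phase (suc (p′ + w)) b (p′ + w ∸ u) j))
occ≡∑<covered {p′} {w} {b} {u} k u≤Q =
  trans (length-filter-oneTo (λ j → suc u ∈? bracket (suc p′) (suc (p′ + w)) b j) (suc k))
        (∑<-cong (suc k) (λ j → 𝟙-cong _ _ (∈-bracket⇔covered j u≤Q)))

occ-agree : ∀ {p′ w b u v k} → w ≡ b + b → w ≤ suc p′ → u ≤ v → v < w + u → v ≤ p′ →
  suc u ∈ bracket (suc p′) (suc (p′ + w)) b (suc k) → suc v ∈ bracket (suc p′) (suc (p′ + w)) b (suc k) →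
  occ (suc p′) (suc (p′ + w)) b (suc u) (suc k) ≡ occ (suc p′) (suc (p′ + w)) b (suc v) (suc k)
occ-agree {p′} {w} {b} {u} {v} {k} w≡b+b w≤p u≤v v<w+u v≤p′ u∈ v∈ = begin
  occ (suc p′) (suc Q) b (suc u) (suc k)              ≡⟨ occ≡∑<covered k u≤Q ⟩
  ∑< (suc k) (λ j → 𝟙 (w ≤? phase (suc Q) b (Q ∸ u) j))
    ≡⟨ cong (λ a′ → ∑< (suc k) (λ j → 𝟙 (w ≤? phase (suc Q) b a′ j))) a+δ≡Q∸u ⟨
  ∑< (suc k) (covered ∘ h)                            ≡⟨ counts-agree k v-covered u-covered ⟨
  ∑< (suc k) (covered ∘ g)                            ≡⟨ occ≡∑<covered k v≤Q ⟨
  occ (suc p′) (suc Q) b (suc v) (suc k)              ∎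
  where
    open ≡-Reasoning
    Q : ℕ
    Q = p′ + w
    v≤Q : v ≤ Q
    v≤Q = ≤-trans v≤p′ (m≤m+n p′ w)
    u≤Q : u ≤ Q
    u≤Q = ≤-trans u≤v v≤Q
    a+δ≡Q∸u : (Q ∸ v) + (v ∸ u) ≡ Q ∸ u
    a+δ≡Q∸u = trans (sym (+-∸-assoc (Q ∸ v) u≤v)) (cong (_∸ u) (m∸n+n≡m v≤Q))
    δ<w : v ∸ u < w
    δ<w = +-cancelʳ-< u (v ∸ u) w (subst (_< w + u) (sym (m∸n+n≡m u≤v)) v<w+u)
    a+δ<q : (Q ∸ v) + (v ∸ u) < suc Q
    a+δ<q = subst (_< suc Q) (sym a+δ≡Q∸u) (s≤s (m∸n≤m Q u))
    open ShiftedOrbits {suc Q} {b} {w} {Q ∸ v} {v ∸ u} w≡b+b (+-monoˡ-≤ w w≤p) δ<w (m≤[n+m]∸o v≤p′) a+δ<q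
    v-covered : w ≤ g k
    v-covered = Equivalence.to (∈-bracket⇔covered k v≤Q) v∈
    u-covered : w ≤ h k
    u-covered = subst (λ a′ → w ≤ phase (suc Q) b a′ k) (sym a+δ≡Q∸u)
                      (Equivalence.to (∈-bracket⇔covered k u≤Q) u∈)

Interval-0 : ∀ {i m} → ¬ Interval i m 0
Interval-0 {i} (i+1≤0 , _) with subst (_≤ 0) (+-comm i 1) i+1≤0
... | ()

Interval-close : ∀ {i m u v} → Interval i m (suc u) → Interval i m (suc v) → v < m + u
Interval-close {i} {m} {u} {v} (i+1≤1+u , _) (_ , v<i+m) = begin-strict
  v      <⟨ v<i+m ⟩
  i + m  ≡⟨ +-comm i m ⟩
  m + i  ≤⟨ +-monoʳ-≤ m (≤-pred (subst (_≤ suc u) (+-comm i 1) i+1≤1+u)) ⟩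
  m + u  ∎
  where open ≤-Reasoning

occ-agree-on-interval : ∀ {p′ b i u v k} → 2 * b ≤ suc p′ → i ≤ suc p′ ∸ 2 * b →
  Interval i (2 * b) (suc u) → Interval i (2 * b) (suc v) →
  suc u ∈ bracket (suc p′) (suc p′ + 2 * b) b (suc k) → suc v ∈ bracket (suc p′) (suc p′ + 2 * b) b (suc k) →
  occ (suc p′) (suc p′ + 2 * b) b (suc u) (suc k) ≡ occ (suc p′) (suc p′ + 2 * b) b (suc v) (suc k)
occ-agree-on-interval {p′} {b} {i} {u} {v} w≤p i≤p∸w u∈I v∈I u∈ v∈ =
  case ≤-total u v of λ where
    (inj₁ u≤v) → occ-agree w≡b+b w≤p u≤v (Interval-close u∈I v∈I) (≤p′ v∈I) u∈ v∈
    (inj₂ v≤u) → sym (occ-agree w≡b+b w≤p v≤u (Interval-close v∈I u∈I) (≤p′ u∈I) v∈ u∈)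
  where
    w≡b+b : 2 * b ≡ b + b
    w≡b+b = cong (b +_) (+-identityʳ b)
    ≤p′ : ∀ {x} → Interval i (2 * b) (suc x) → x ≤ p′
    ≤p′ (_ , x<i+w) = ≤-pred (<-≤-trans x<i+w (m≤o∸n⇒m+n≤o i w≤p i≤p∸w))

lemma13 : (p q b : ℕ) → 0 < p → p < q → q ≡ p + 2 * b → 2 * b ≤ p →
    (i : ℕ) → i ≤ p ∸ 2 * b →
    Consistent p q b (Interval i (2 * b))
lemma13 zero _ _ () _ _ _ _ _
lemma13 (suc p′) _ b _ _ refl w≤p i i≤p∸w zero    _       _       _  0∈I _   _ = Interval-0 0∈I
lemma13 (suc p′) _ b _ _ refl w≤p i i≤p∸w (suc u) zero    _       _  _   0∈I _ = Interval-0 0∈I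
lemma13 (suc p′) _ b _ _ refl w≤p i i≤p∸w (suc u) (suc v) zero    ()
lemma13 (suc p′) _ b _ _ refl w≤p i i≤p∸w (suc u) (suc v) (suc k) _  u∈I v∈I (u∈ , v∈ , occ-v≡occ-u+2) =
  m≢1+n+m _ (trans (occ-agree-on-interval w≤p i≤p∸w u∈I v∈I u∈ v∈) (trans occ-v≡occ-u+2 (+-comm _ 2)))
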